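{- Let $A$ be a set and, for each $a \in A$, let $C(a) \subseteq A$, so that $(A,C)$ is a singleton inductively generated formal topology with cover relation $\vartriangleleft$. Let $U \subseteq A$ be a decidable subset (membership in $U$ is decidable). Define, for each $a \in A$, $C'(a) = \emptyset$ if $a \in U$ and $C'(a) = C(a)$ otherwise, and let $\vartriangleleft'$ be the cover relation of the singleton inductively generated formal topology $(A,C')$. Then for every $a \in A$, $a \vartriangleleft U$ if and only if $a \vartriangleleft' \emptyset$.
   Context: A singleton inductively generated formal topology is a pair $(A,C)$ where $A$ is a set and $C(a)$ is a subset of $A$ for each $a \in A$. Its formal cover relation $a \vartriangleleft V$, between elements $a \in A$ and subsets $V \subseteq A$, is the relation inductively generated by the two rules: (reflexivity) if $a \in V$ then $a \vartriangleleft V$; (infinity) if $y \vartriangleleft V$ for all $y \in C(a)$, then $a \vartriangleleft V$. That is, it is the least relation closed under these rules. The work is carried out in constructive (intuitionistic) type theory, which is why decidability of $U$ is assumed. -}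

module Defs where

open import Level using (Level; _⊔_; suc; Lift)
open import Data.Empty using (⊥)
open import Relation.Unary using (Pred; _∈_; Decidable)
open import Relation.Nullary using (yes; no)

-- The empty subset of A, at an arbitrary universe level
-- (the stdlib ∅ lives only at level 0).
∅ℓ : {a : Level} {A : Set a} (ℓ : Level) → Pred A ℓ
∅ℓ ℓ _ = Lift ℓ ⊥

data _◁[_]_ {a ℓ ℓ′ : Level} {A : Set a}
       (x : A) (C : A → Pred A ℓ) (V : Pred A ℓ′) : Set (a ⊔ ℓ ⊔ ℓ′) where
  refl◁ : x ∈ V → x ◁[ C ] V
  inf◁  : (∀ y → y ∈ C x → y ◁[ C ] V) → x ◁[ C ] V

restrict : {a ℓ ℓ′ : Level} {A : Set a} (C : A → Pred A ℓ)
           (U : Pred A ℓ′) → Decidable U → A → Pred A ℓ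
restrict {ℓ = ℓ} C U U? x with U? x
... | yes _ = ∅ℓ ℓ
... | no _  = C x

-- Both directions are inductions on the cover derivation.
--   (⇒) A point x ∈ U has C′(x) = ∅, so the infinity rule covers it by
--       anything, in particular by ∅.  A point x ∉ U can only be covered
--       by U through the infinity rule, and C′(x) = C(x) lets us replay it.
--   (⇐) Nothing is covered by ∅ reflexively, so the last rule is the
--       infinity rule at x; if x ∈ U we conclude by reflexivity, otherwise
--       C′(x) = C(x) and we replay the rule in (A , C).
module Submission where

open import Defs
open import Level using (Level; lift)
open import Relation.Unary using (Pred; Decidable; _∈_; _∉_; Empty)
open import Relation.Nullary using (Dec; yes; no; contradiction)
open import Function.Bundles using (_⇔_; mk⇔)

no-basic-covers⇒covered : {ℓa ℓ ℓ′ : Level} {A : Set ℓa}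
  (C : A → Pred A ℓ) (V : Pred A ℓ′) (x : A) → Empty (C x) → x ◁[ C ] V
no-basic-covers⇒covered C V x empty = inf◁ (λ y y∈Cx → contradiction y∈Cx (empty y))

module _ {ℓa ℓ ℓ′ : Level} {A : Set ℓa} (C : A → Pred A ℓ) (U : Pred A ℓ′)
         (U? : Decidable U) where

  C′ : A → Pred A ℓ
  C′ = restrict C U U?

  C′-empty-on-U : ∀ {x} → x ∈ U → Empty (C′ x)
  C′-empty-on-U {x} x∈U y with U? x
  ... | yes _   = λ ()
  ... | no x∉U  = contradiction x∈U x∉U

  C′⊆C-off-U : ∀ {x} → x ∉ U → ∀ y → y ∈ C′ x → y ∈ C x
  C′⊆C-off-U {x} x∉U y with U? x
  ... | yes x∈U = contradiction x∈U x∉U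
  ... | no _    = λ y∈Cx → y∈Cx

  C⊆C′-off-U : ∀ {x} → x ∉ U → ∀ y → y ∈ C x → y ∈ C′ x
  C⊆C′-off-U {x} x∉U y with U? x
  ... | yes x∈U = contradiction x∈U x∉U
  ... | no _    = λ y∈Cx → y∈Cx

  ◁U⇒◁′∅ : ∀ x → x ◁[ C ] U → x ◁[ C′ ] ∅ℓ ℓ′
  ◁U⇒◁′∅ x x◁U = by-cases (U? x) x◁U
    where
    by-cases : Dec (x ∈ U) → x ◁[ C ] U → x ◁[ C′ ] ∅ℓ ℓ′
    by-cases (yes x∈U) _           = no-basic-covers⇒covered C′ _ x (C′-empty-on-U x∈U)
    by-cases (no x∉U)  (refl◁ x∈U) = contradiction x∈U x∉U
    by-cases (no x∉U)  (inf◁ h)    =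
      inf◁ (λ y y∈C′x → ◁U⇒◁′∅ y (h y (C′⊆C-off-U x∉U y y∈C′x)))

  ◁′∅⇒◁U : ∀ x → x ◁[ C′ ] ∅ℓ ℓ′ → x ◁[ C ] U
  ◁′∅⇒◁U x (refl◁ (lift ()))
  ◁′∅⇒◁U x (inf◁ h) = by-cases (U? x)
    where
    by-cases : Dec (x ∈ U) → x ◁[ C ] U
    by-cases (yes x∈U) = refl◁ x∈U
    by-cases (no x∉U)  =
      inf◁ (λ y y∈Cx → ◁′∅⇒◁U y (h y (C⊆C′-off-U x∉U y y∈Cx)))

lemma1 : {ℓa ℓ ℓ′ : Level} {A : Set ℓa} (C : A → Pred A ℓ) (U : Pred A ℓ′)
         (U? : Decidable U) (a : A) →
         (a ◁[ C ] U) ⇔ (a ◁[ restrict C U U? ] ∅ℓ {A = A} ℓ′)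
lemma1 C U U? a = mk⇔ (◁U⇒◁′∅ C U U? a) (◁′∅⇒◁U C U U? a)
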